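{- Let $t$ be a closed term. If $d\colon t\to_{\mathrm{cbv}}^{*} s$ with $\mathrm{normal}_{\mathrm{cbv}}(s)$, then there is a tight derivation in the CbV type system of $\vdash^{(|d|_m,|d|_e)} t:\mathbf 0$.
   Context: Terms: $t,s ::= x \mid \lambda x.t \mid t\,s \mid t[x\leftarrow s]$, where $t[x\leftarrow s]$ (explicit substitution) binds $x$ in $t$; values $v ::= \lambda x.t$. $\mathrm{fv}(t[x\leftarrow s])=(\mathrm{fv}(t)\setminus\{x\})\cup\mathrm{fv}(s)$; closed means no free variables; terms up to $\alpha$-equivalence. Contexts: CbV (= weak) contexts $V ::= \langle\cdot\rangle \mid V t \mid V[x\leftarrow t] \mid t V \mid t[x\leftarrow V]$; substitution contexts $S ::= \langle\cdot\rangle \mid S[x\leftarrow t]$; $V\langle t\rangle$ plugging (may capture), $V\langle\langle t\rangle\rangle$ plugging where $V$ does not capture free variables of $t$. Root steps: $S\langle\lambda x.t\rangle s\mapsto_m S\langle t[x\leftarrow s]\rangle$ (variables bound by $S$ disjoint from $\mathrm{fv}(s)$); $V\langle\langle x\rangle\rangle[x\leftarrow S\langle v\rangle]\mapsto_e S\langle V\langle\langle v\rangle\rangle[x\leftarrow v]\rangle$ (variables bound by $S$ disjoint from $\mathrm{fv}(V\langle\langle x\rangle\rangle)$). $\to_{m,\mathrm{cbv}}$ (resp. $\to_{e,\mathrm{cbv}}$) relates $V\langle t'\rangle$ to $V\langle s'\rangle$ for any CbV context $V$ when $t'\mapsto_m s'$ (resp. $\mapsto_e$); $\to_{\mathrm{cbv}}$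 is their union. $|d|_m,|d|_e$ count multiplicative and exponential steps of $d$. $\mathrm{normal}_{\mathrm{cbv}}$: least predicate with $\mathrm{normal}_{\mathrm{cbv}}(\lambda x.t)$ and ($\mathrm{normal}_{\mathrm{cbv}}(t)$ and $\mathrm{normal}_{\mathrm{cbv}}(s)$) $\Rightarrow\mathrm{normal}_{\mathrm{cbv}}(t[x\leftarrow s])$. CbV types: linear types $L ::= M\to N$; multi types $M,N ::= [L_i]_{i\in J}$ finite multisets, $\mathbf 0$ empty multiset, $\uplus$ union. Type contexts $\Gamma$ map variables to multi types, all but finitely many to $\mathbf 0$; $\mathrm{dom}(\Gamma)=\{x\mid\Gamma(x)\ne\mathbf 0\}$; empty if domain empty; $\uplus$ pointwise; $\Gamma,x:M$ means $\Gamma\uplus(x\mapsto M)$ with $x\notin\mathrm{dom}(\Gamma)$. Rules: (ax) $x:M\vdash^{(0,1)} x:M$ for any multi type $M$; (app) from $\Gamma\vdash^{(m,e)} t:[M\to N]$ and $\Pi\vdash^{(m',e')} s:M$ infer $\Gamma\uplus\Pi\vdash^{(m+m'+1,e+e')} t\,s:N$; (fun) from $\Gamma,x:N\vdash^{(m,e)} t:M$ infer $\Gamma\vdash^{(m,e)}\lambda x.t:N\to M$; (many) from $\Pi_i\vdash^{(m_i,e_i)}\lambda x.t:L_i$ for $i\in J$ ($J$ finite, possibly empty) infer $\biguplus_i\Pi_i\vdash^{(\sum m_i,\sum e_i)}\lambda x.t:[L_i]_{i\in J}$; (ES) from $\Gamma,x:N\vdash^{(m,e)} t:M$ and $\Pi\vdash^{(m',e')}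 s:N$ infer $\Gamma\uplus\Pi\vdash^{(m+m',e+e')} t[x\leftarrow s]:M$. A derivation of $\Gamma\vdash^{(m,e)} t:M$ is tight if $M=\mathbf 0$ and $\Gamma$ is empty. -}

module Defs where

open import Data.Nat using (ℕ; zero; suc; _+_)
open import Data.Fin using (Fin; zero; suc)
open import Data.Fin.Properties using (_≟_)
open import Data.List using (List; []; _∷_; _++_; [_])
open import Data.List.Relation.Binary.Permutation.Homogeneous using (Permutation)
open import Relation.Nullary using (yes; no)

-- Terms (well-scoped de Bruijn; α-equivalence is syntactic identity).
-- Tm n = terms with free variables among Fin n; var zero = innermost binder.

data Tm (n : ℕ) : Set where
  var : Fin n → Tm n
  lam : Tm (suc n) → Tm n
  app : Tm n → Tm n → Tm n
  es  : Tm (suc n) → Tm n → Tm n          -- t[x←s], binds x in t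

liftR : ∀ {n m} → (Fin n → Fin m) → Fin (suc n) → Fin (suc m)
liftR ρ zero    = zero
liftR ρ (suc i) = suc (ρ i)

ren : ∀ {n m} → (Fin n → Fin m) → Tm n → Tm m
ren ρ (var x)  = var (ρ x)
ren ρ (lam t)  = lam (ren (liftR ρ) t)
ren ρ (app t s) = app (ren ρ t) (ren ρ s)
ren ρ (es t s) = es (ren (liftR ρ) t) (ren ρ s)

-- Scope after going under k binders: k ⊕ n
_⊕_ : ℕ → ℕ → ℕ
zero  ⊕ n = n
suc k ⊕ n = k ⊕ suc n

wkR : ∀ {n} (k : ℕ) → Fin n → Fin (k ⊕ n)
wkR zero    i = i
wkR (suc k) i = wkR k (suc i)

wk : ∀ {n} (k : ℕ) → Tm n → Tm (k ⊕ n)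
wk k = ren (wkR k)

-- CbV (weak) contexts  V ::= ⟨·⟩ | V t | V[x←t] | t V | t[x←V]
-- VCtx n k : context in scope n whose hole is under k binders
-- (hole scope k ⊕ n).

data VCtx : ℕ → ℕ → Set where
  hole : ∀ {n} → VCtx n zero
  appL : ∀ {n k} → VCtx n k → Tm n → VCtx n k
  esL  : ∀ {n k} → VCtx (suc n) k → Tm n → VCtx n (suc k)
  appR : ∀ {n k} → Tm n → VCtx n k → VCtx n k
  esR  : ∀ {n k} → Tm (suc n) → VCtx n k → VCtx n k

-- plugging V⟨t⟩ (may capture)
plugV : ∀ {n k} → VCtx n k → Tm (k ⊕ n) → Tm n
plugV hole       t = t
plugV (appL V u) t = app (plugV V t) u
plugV (esL V u)  t = es (plugV V t) u
plugV (appR u V) t = app u (plugV V t)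
plugV (esR u V)  t = es u (plugV V t)

-- capture-avoiding plugging V⟨⟨t⟩⟩ : t lives in the outer scope of V
plugV⟪_⟫ : ∀ {n k} → VCtx n k → Tm n → Tm n
plugV⟪_⟫ {k = k} V t = plugV V (wk k t)

renV : ∀ {n m k} → (Fin n → Fin m) → VCtx n k → VCtx m k
renV ρ hole       = hole
renV ρ (appL V u) = appL (renV ρ V) (ren ρ u)
renV ρ (esL V u)  = esL (renV (liftR ρ) V) (ren ρ u)
renV ρ (appR u V) = appR (ren ρ u) (renV ρ V)
renV ρ (esR u V)  = esR (ren (liftR ρ) u) (renV ρ V)

data SCtx : ℕ → ℕ → Set where
  hole : ∀ {n} → SCtx n zero
  esL  : ∀ {n k} → SCtx (suc n) k → Tm n → SCtx n (suc k)

plugS : ∀ {n k} → SCtx n k → Tm (k ⊕ n) → Tm n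
plugS hole      t = t
plugS (esL S u) t = es (plugS S t) u

-- Root steps.  The side conditions of the paper ("variables bound by S
-- are disjoint from fv(...)") are realised by weakening across S.

data RootM {n : ℕ} : Tm n → Tm n → Set where
  -- S⟨λx.t⟩ s ↦m S⟨t[x←s]⟩
  rootM : ∀ {k} (S : SCtx n k) (t : Tm (suc (k ⊕ n))) (s : Tm n) →
          RootM (app (plugS S (lam t)) s) (plugS S (es t (wk k s)))

data RootE {n : ℕ} : Tm n → Tm n → Set where
  -- V⟨⟨x⟩⟩[x←S⟨v⟩] ↦e S⟨V⟨⟨v⟩⟩[x←v]⟩
  rootE : ∀ {k j} (V : VCtx (suc n) k) (S : SCtx n j) (b : Tm (suc (j ⊕ n))) →
          RootE (es (plugV⟪ V ⟫ (var zero)) (plugS S (lam b)))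
                (plugS S (es (plugV⟪ renV (liftR (wkR j)) V ⟫ (ren suc (lam b))) (lam b)))

data Kind : Set where
  mul exp : Kind

Root : ∀ {n} → Kind → Tm n → Tm n → Set
Root mul = RootM
Root exp = RootE

data Step {n : ℕ} (κ : Kind) : Tm n → Tm n → Set where
  ctx : ∀ {k} (V : VCtx n k) {t s : Tm (k ⊕ n)} → Root κ t s →
        Step κ (plugV V t) (plugV V s)

data _⟶*_ {n : ℕ} : Tm n → Tm n → Set where
  done : ∀ {t} → t ⟶* t
  step : ∀ {t u s} (κ : Kind) → Step κ t u → u ⟶* s → t ⟶* s

∣_∣m : ∀ {n} {t s : Tm n} → t ⟶* s → ℕ
∣ done ∣m         = zero
∣ step mul _ d ∣m   = suc ∣ d ∣m
∣ step exp _ d ∣m   = ∣ d ∣m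

∣_∣e : ∀ {n} {t s : Tm n} → t ⟶* s → ℕ
∣ done ∣e         = zero
∣ step mul _ d ∣e   = ∣ d ∣e
∣ step exp _ d ∣e   = suc ∣ d ∣e

data Normal {n : ℕ} : Tm n → Set where
  lam : ∀ {t} → Normal (lam t)
  es  : ∀ {t s} → Normal t → Normal s → Normal (es t s)

-- CbV types.  Multisets are lists considered up to (deep) permutation.

data Lin : Set where
  _⇒_ : List Lin → List Lin → Lin

Multi : Set
Multi = List Lin

𝟎 : Multi
𝟎 = []

data _≈L_ : Lin → Lin → Set where
  ⇒≈ : ∀ {M M′ N N′} → Permutation _≈L_ M M′ → Permutation _≈L_ N N′ →
       (M ⇒ N) ≈L (M′ ⇒ N′)

_≈M_ : Multi → Multi → Set
_≈M_ = Permutation _≈L_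

TCtx : ℕ → Set
TCtx n = Fin n → Multi

∅ : ∀ {n} → TCtx n
∅ _ = 𝟎

_⊎_ : ∀ {n} → TCtx n → TCtx n → TCtx n
(Γ ⊎ Π) x = Γ x ++ Π x

_≈C_ : ∀ {n} → TCtx n → TCtx n → Set
Γ ≈C Δ = ∀ x → Γ x ≈M Δ x

_,∶_ : ∀ {n} → TCtx n → Multi → TCtx (suc n)
(Γ ,∶ M) zero    = M
(Γ ,∶ M) (suc x) = Γ x

single : ∀ {n} → Fin n → Multi → TCtx n
single x M y with y ≟ x
... | yes _ = M
... | no  _ = 𝟎

-- The rule `conv` makes judgments invariant under the multiset
-- equivalence, i.e. it realises the quotient of lists into multisets.
data _⊢⟨_,_⟩_∶_ {n : ℕ} : TCtx n → ℕ → ℕ → Tm n → Multi → Set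
data _⊢ᴸ⟨_,_⟩_∶_ {n : ℕ} : TCtx n → ℕ → ℕ → Tm n → Lin → Set
data Many {n : ℕ} (t : Tm (suc n)) : TCtx n → ℕ → ℕ → Multi → Set

data _⊢⟨_,_⟩_∶_ {n} where
  ax   : ∀ (x : Fin n) (M : Multi) → single x M ⊢⟨ 0 , 1 ⟩ var x ∶ M
  app  : ∀ {Γ Π m e m′ e′ t s M N} →
         Γ ⊢⟨ m , e ⟩ t ∶ [ M ⇒ N ] → Π ⊢⟨ m′ , e′ ⟩ s ∶ M →
         (Γ ⊎ Π) ⊢⟨ m + m′ + 1 , e + e′ ⟩ app t s ∶ N
  many : ∀ {Π m e t M} → Many t Π m e M → Π ⊢⟨ m , e ⟩ lam t ∶ M
  ES   : ∀ {Γ Π m e m′ e′ t s M N} →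
         (Γ ,∶ N) ⊢⟨ m , e ⟩ t ∶ M → Π ⊢⟨ m′ , e′ ⟩ s ∶ N →
         (Γ ⊎ Π) ⊢⟨ m + m′ , e + e′ ⟩ es t s ∶ M
  conv : ∀ {Γ Γ′ m e t M M′} → Γ ⊢⟨ m , e ⟩ t ∶ M → Γ ≈C Γ′ → M ≈M M′ →
         Γ′ ⊢⟨ m , e ⟩ t ∶ M′

data _⊢ᴸ⟨_,_⟩_∶_ {n} where
  fun : ∀ {Γ m e t N M} → (Γ ,∶ N) ⊢⟨ m , e ⟩ t ∶ M →
        Γ ⊢ᴸ⟨ m , e ⟩ lam t ∶ (N ⇒ M)

-- the finite family of premises of rule (many), indexed by J
data Many {n} t where
  []  : Many t ∅ 0 0 []
  _∷_ : ∀ {Π Γ m e m′ e′ L M} → Π ⊢ᴸ⟨ m , e ⟩ lam t ∶ L → Many t Γ m′ e′ M →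
        Many t (Π ⊎ Γ) (m + m′) (e + e′) (L ∷ M)

Tight : ∀ {n} → ℕ → ℕ → Tm n → Set
Tight m e t = ∅ ⊢⟨ m , e ⟩ t ∶ 𝟎

-- A normal form has a tight derivation
-- with counters (0,0) (normal-tight), and derivations are pulled back along
-- each step by subject expansion with exact counting: a multiplicative step
-- raises the first counter by one, an exponential step the second one
-- (expand-stepM, expand-stepE).  Expansion is proved at the root and moved
-- through the surrounding CbV context.

module Submission where

open import Defs
open import Algebra.Bundles using (CommutativeMonoid)
import Algebra.Properties.CommutativeSemigroup as CommSemigroupProperties
open import Data.Nat using (ℕ; zero; suc; _+_)
open import Data.Nat.Properties
  using (+-assoc; +-suc; +-identityʳ; +-comm; +-commutativeSemigroup)
open import Data.Nat.Tactic.RingSolver using (solve-∀)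
open import Data.Fin using (Fin; zero; suc)
open import Data.Fin.Properties using (_≟_; suc-injective)
open import Data.List using ([]; _∷_; _++_; [_])
open import Data.List.Relation.Binary.Pointwise.Base using (Pointwise; []; _∷_)
import Data.List.Relation.Binary.Permutation.Homogeneous as Perm
import Data.List.Relation.Binary.Permutation.Setoid.Properties as PermProperties
open import Data.Product using (Σ; _×_; _,_)
open import Data.Empty using (⊥-elim)
open import Relation.Nullary using (yes; no; Dec; ¬_)
open import Relation.Binary.Bundles using (Setoid)
open import Relation.Binary.PropositionalEquality
  using (_≡_; refl; sym; trans; cong; subst)

mutual
  ≈L-refl : ∀ L → L ≈L L
  ≈L-refl (M ⇒ N) = ⇒≈ (≈M-refl M) (≈M-refl N)

  ≈M-refl : ∀ M → M ≈M M
  ≈M-refl M = Perm.refl (pointwise-refl M)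

  pointwise-refl : ∀ M → Pointwise _≈L_ M M
  pointwise-refl []      = []
  pointwise-refl (L ∷ M) = ≈L-refl L ∷ pointwise-refl M

mutual
  ≈L-sym : ∀ {L L′} → L ≈L L′ → L′ ≈L L
  ≈L-sym (⇒≈ p q) = ⇒≈ (≈M-sym p) (≈M-sym q)

  ≈M-sym : ∀ {M M′} → M ≈M M′ → M′ ≈M M
  ≈M-sym (Perm.refl ps)     = Perm.refl (pointwise-sym ps)
  ≈M-sym (Perm.prep p ps)   = Perm.prep (≈L-sym p) (≈M-sym ps)
  ≈M-sym (Perm.swap p q ps) = Perm.swap (≈L-sym q) (≈L-sym p) (≈M-sym ps)
  ≈M-sym (Perm.trans ps qs) = Perm.trans (≈M-sym qs) (≈M-sym ps)

  pointwise-sym : ∀ {M M′} → Pointwise _≈L_ M M′ → Pointwise _≈L_ M′ M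
  pointwise-sym []       = []
  pointwise-sym (p ∷ ps) = ≈L-sym p ∷ pointwise-sym ps

≈M-trans : ∀ {M M′ M″} → M ≈M M′ → M′ ≈M M″ → M ≈M M″
≈M-trans = Perm.trans

≈L-trans : ∀ {L L′ L″} → L ≈L L′ → L′ ≈L L″ → L ≈L L″
≈L-trans (⇒≈ p q) (⇒≈ p′ q′) = ⇒≈ (≈M-trans p p′) (≈M-trans q q′)

LinSetoid : Setoid _ _
LinSetoid = record
  { Carrier       = Lin
  ; _≈_           = _≈L_
  ; isEquivalence = record { refl = ≈L-refl _ ; sym = ≈L-sym ; trans = ≈L-trans } }

module Multiset = PermProperties LinSetoid
module MultisetCS =
  CommSemigroupProperties (CommutativeMonoid.commutativeSemigroup Multiset.++-commutativeMonoid)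

_++-cong_ : ∀ {A B C D} → A ≈M B → C ≈M D → (A ++ C) ≈M (B ++ D)
_++-cong_ = Multiset.++⁺

≈M-reflexive : ∀ {A B} → A ≡ B → A ≈M B
≈M-reflexive {A} refl = ≈M-refl A

≈C-refl : ∀ {n} {Γ : TCtx n} → Γ ≈C Γ
≈C-refl {Γ = Γ} x = ≈M-refl (Γ x)

≈C-sym : ∀ {n} {Γ Δ : TCtx n} → Γ ≈C Δ → Δ ≈C Γ
≈C-sym c x = ≈M-sym (c x)

≈C-trans : ∀ {n} {Γ Δ Ξ : TCtx n} → Γ ≈C Δ → Δ ≈C Ξ → Γ ≈C Ξ
≈C-trans c d x = ≈M-trans (c x) (d x)

_⊎-cong_ : ∀ {n} {A B C D : TCtx n} → A ≈C B → C ≈C D → (A ⊎ C) ≈C (B ⊎ D)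
(c ⊎-cong d) x = c x ++-cong d x

⊎-identityʳ : ∀ {n} (Γ : TCtx n) → (Γ ⊎ ∅) ≈C Γ
⊎-identityʳ Γ x = Multiset.++-identityʳ (Γ x)

tailC : ∀ {n} → TCtx (suc n) → TCtx n
tailC Γ x = Γ (suc x)

ctx-η : ∀ {n} (Γ : TCtx (suc n)) → Γ ≈C (tailC Γ ,∶ Γ zero)
ctx-η Γ zero    = ≈M-refl (Γ zero)
ctx-η Γ (suc x) = ≈M-refl (Γ (suc x))

split-head : ∀ {n} {G : TCtx (suc n)} {N} → G zero ≈M N → G ≈C (tailC G ,∶ N)
split-head p zero              = p
split-head {G = G} p (suc x) = ≈M-refl (G (suc x))

cancel-𝟎ʳ : ∀ {A B} → (A ++ 𝟎) ≈M (B ++ 𝟎) → A ≈M B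
cancel-𝟎ʳ {A} {B} p =
  ≈M-trans (≈M-sym (Multiset.++-identityʳ A)) (≈M-trans p (Multiset.++-identityʳ B))

-- Trading: Γ′ ⊎ Δ₁ ≈ Γ ⊎ Δ₂ says that Γ′ arises from Γ by giving away Δ₁
-- and receiving Δ₂.  Trading in a part of a sum trades in the whole sum.
trade-⊎ʳ : ∀ {n} {Γ A A′ P Δ₁ Δ₂ : TCtx n} → Γ ≈C (A ⊎ P) →
           (A ⊎ Δ₂) ≈C (A′ ⊎ Δ₁) → (Γ ⊎ Δ₂) ≈C ((A′ ⊎ P) ⊎ Δ₁)
trade-⊎ʳ {A = A} {A′} {P} {Δ₁} {Δ₂} cx c x =
  ≈M-trans (cx x ++-cong ≈M-refl (Δ₂ x))
  (≈M-trans (MultisetCS.xy∙z≈xz∙y (A x) (P x) (Δ₂ x))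
  (≈M-trans (c x ++-cong ≈M-refl (P x))
            (MultisetCS.xy∙z≈xz∙y (A′ x) (Δ₁ x) (P x))))

trade-⊎ʳ₁ : ∀ {n} {Γ A A′ P Δ : TCtx n} → Γ ≈C (A ⊎ P) →
            A ≈C (A′ ⊎ Δ) → Γ ≈C ((A′ ⊎ P) ⊎ Δ)
trade-⊎ʳ₁ {A′ = A′} {P} {Δ} cx c x =
  ≈M-trans (cx x) (≈M-trans (c x ++-cong ≈M-refl (P x)) (MultisetCS.xy∙z≈xz∙y (A′ x) (Δ x) (P x)))

trade-⊎ˡ : ∀ {n} {Γ A A′ P Δ₁ Δ₂ : TCtx n} → Γ ≈C (P ⊎ A) →
           (A ⊎ Δ₂) ≈C (A′ ⊎ Δ₁) → (Γ ⊎ Δ₂) ≈C ((P ⊎ A′) ⊎ Δ₁)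
trade-⊎ˡ {A = A} {A′} {P} {Δ₁} {Δ₂} cx c x =
  ≈M-trans (cx x ++-cong ≈M-refl (Δ₂ x))
  (≈M-trans (Multiset.++-assoc (P x) (A x) (Δ₂ x))
  (≈M-trans (≈M-refl (P x) ++-cong c x)
            (≈M-sym (Multiset.++-assoc (P x) (A′ x) (Δ₁ x)))))

castD : ∀ {n} {Γ : TCtx n} {m e m′ e′ t M} → m ≡ m′ → e ≡ e′ →
        Γ ⊢⟨ m , e ⟩ t ∶ M → Γ ⊢⟨ m′ , e′ ⟩ t ∶ M
castD refl refl d = d

convC : ∀ {n} {Γ Γ′ : TCtx n} {m e t M} → Γ ≈C Γ′ →
        Γ ⊢⟨ m , e ⟩ t ∶ M → Γ′ ⊢⟨ m , e ⟩ t ∶ M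
convC c d = conv d c (≈M-refl _)

convT : ∀ {n} {Γ : TCtx n} {m e t M M′} → M ≈M M′ →
        Γ ⊢⟨ m , e ⟩ t ∶ M → Γ ⊢⟨ m , e ⟩ t ∶ M′
convT p d = conv d ≈C-refl p

single-self : ∀ {n} (x : Fin n) M → single x M x ≡ M
single-self x M with x ≟ x
... | yes _ = refl
... | no x≢x = ⊥-elim (x≢x refl)

single-other : ∀ {n} {x y : Fin n} M → ¬ y ≡ x → single x M y ≡ 𝟎
single-other {x = x} {y} M y≢x with y ≟ x
... | yes y≡x = ⊥-elim (y≢x y≡x)
... | no _    = refl

single-cong : ∀ {n} (x : Fin n) {M M′} → M ≈M M′ → single x M ≈C single x M′
single-cong x p y with y ≟ x
... | yes _ = p
... | no _  = ≈M-refl 𝟎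

single-suc : ∀ {n} (x y : Fin n) M → single (suc x) M (suc y) ≡ single x M y
single-suc x y M = by-cases (y ≟ x)
  where
  by-cases : Dec (y ≡ x) → single (suc x) M (suc y) ≡ single x M y
  by-cases (yes refl) = trans (single-self (suc x) M) (sym (single-self x M))
  by-cases (no y≢x)   =
    trans (single-other M (λ p → y≢x (suc-injective p))) (sym (single-other M y≢x))

record InvApp {n} (Γ : TCtx n) (m e : ℕ) (t s : Tm n) (N : Multi) : Set where
  constructor invApp
  field
    Γ₁ Π₁ : TCtx n
    M₁ : Multi
    m₁ e₁ m₂ e₂ : ℕ
    dt : Γ₁ ⊢⟨ m₁ , e₁ ⟩ t ∶ [ M₁ ⇒ N ]
    ds : Π₁ ⊢⟨ m₂ , e₂ ⟩ s ∶ M₁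
    cx : Γ ≈C (Γ₁ ⊎ Π₁)
    em : m ≡ m₁ + m₂ + 1
    ee : e ≡ e₁ + e₂

inv-app : ∀ {n} {Γ : TCtx n} {m e t s N} → Γ ⊢⟨ m , e ⟩ app t s ∶ N → InvApp Γ m e t s N
inv-app (app dt ds) = invApp _ _ _ _ _ _ _ dt ds ≈C-refl refl refl
inv-app (conv d c p) with inv-app d
... | invApp Γ₁ Π₁ M₁ m₁ e₁ m₂ e₂ dt ds cx em ee =
  invApp Γ₁ Π₁ M₁ m₁ e₁ m₂ e₂ (convT arrow≈ dt) ds (≈C-trans (≈C-sym c) cx) em ee
  where arrow≈ = Perm.prep (⇒≈ (≈M-refl M₁) p) (Perm.refl [])

record InvES {n} (Γ : TCtx n) (m e : ℕ) (t : Tm (suc n)) (s : Tm n) (M : Multi) : Set where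
  constructor invES
  field
    Γ₁ Π₁ : TCtx n
    N : Multi
    m₁ e₁ m₂ e₂ : ℕ
    dt : (Γ₁ ,∶ N) ⊢⟨ m₁ , e₁ ⟩ t ∶ M
    ds : Π₁ ⊢⟨ m₂ , e₂ ⟩ s ∶ N
    cx : Γ ≈C (Γ₁ ⊎ Π₁)
    em : m ≡ m₁ + m₂
    ee : e ≡ e₁ + e₂

inv-es : ∀ {n} {Γ : TCtx n} {m e t s M} → Γ ⊢⟨ m , e ⟩ es t s ∶ M → InvES Γ m e t s M
inv-es (ES dt ds) = invES _ _ _ _ _ _ _ dt ds ≈C-refl refl refl
inv-es (conv d c p) with inv-es d
... | invES Γ₁ Π₁ N m₁ e₁ m₂ e₂ dt ds cx em ee =
  invES Γ₁ Π₁ N m₁ e₁ m₂ e₂ (convT p dt) ds (≈C-trans (≈C-sym c) cx) em ee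

record InvVar {n} (Γ : TCtx n) (m e : ℕ) (x : Fin n) (M : Multi) : Set where
  constructor invVar
  field
    em : m ≡ 0
    ee : e ≡ 1
    cx : Γ ≈C single x M

inv-var : ∀ {n} {Γ : TCtx n} {m e x M} → Γ ⊢⟨ m , e ⟩ var x ∶ M → InvVar Γ m e x M
inv-var (ax x M) = invVar refl refl ≈C-refl
inv-var (conv d c p) with inv-var d
... | invVar em ee cx = invVar em ee (≈C-trans (≈C-sym c) (≈C-trans cx (single-cong _ p)))

record InvLam {n} (Γ : TCtx n) (m e : ℕ) (b : Tm (suc n)) (M : Multi) : Set where
  constructor invLam
  field
    Π : TCtx n
    M′ : Multi
    dm : Many b Π m e M′
    cx : Γ ≈C Π
    eM : M′ ≈M M

inv-lam : ∀ {n} {Γ : TCtx n} {m e b M} → Γ ⊢⟨ m , e ⟩ lam b ∶ M → InvLam Γ m e b M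
inv-lam (many dm) = invLam _ _ dm ≈C-refl (≈M-refl _)
inv-lam (conv d c p) with inv-lam d
... | invLam Π M′ dm cx eM = invLam Π M′ dm (≈C-trans (≈C-sym c) cx) (≈M-trans eM p)

-- Rule (many) is additive: two typings of the same abstraction merge into
-- one typing at the union of the multi types.  This is what lets the
-- exponential step duplicate a value.

castMany : ∀ {n} {b : Tm (suc n)} {Π m e m′ e′ M} → m ≡ m′ → e ≡ e′ →
           Many b Π m e M → Many b Π m′ e′ M
castMany refl refl dm = dm

mergeMany : ∀ {n} {b : Tm (suc n)} {Π₁ Π₂ m₁ e₁ m₂ e₂ M₁ M₂} →
  Many b Π₁ m₁ e₁ M₁ → Many b Π₂ m₂ e₂ M₂ →
  Σ (TCtx n) λ Π → Many b Π (m₁ + m₂) (e₁ + e₂) (M₁ ++ M₂) × Π ≈C (Π₁ ⊎ Π₂)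
mergeMany [] dm = _ , dm , ≈C-refl
mergeMany {m₂ = m₂} {e₂ = e₂}
          (_∷_ {Π = P} {Γ = G} {m = m} {e = e} {m′ = m′} {e′ = e′} dL dm) dm′
  with mergeMany dm dm′
... | Π , dm″ , c =
  (P ⊎ Π) ,
  castMany (sym (+-assoc m m′ m₂)) (sym (+-assoc e e′ e₂)) (dL ∷ dm″) ,
  λ x → ≈M-trans (≈M-refl (P x) ++-cong c x) (≈M-sym (Multiset.++-assoc (P x) (G x) _))

mergeLam : ∀ {n} {b : Tm (suc n)} {Π₁ Π₂ m₁ e₁ m₂ e₂ M₁ M₂} →
  Π₁ ⊢⟨ m₁ , e₁ ⟩ lam b ∶ M₁ → Π₂ ⊢⟨ m₂ , e₂ ⟩ lam b ∶ M₂ →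
  (Π₁ ⊎ Π₂) ⊢⟨ m₁ + m₂ , e₁ + e₂ ⟩ lam b ∶ (M₁ ++ M₂)
mergeLam d₁ d₂ with inv-lam d₁ | inv-lam d₂
... | invLam P₁ _ dm₁ c₁ p₁ | invLam P₂ _ dm₂ c₂ p₂ with mergeMany dm₁ dm₂
... | Π , dm , c = conv (many dm) (≈C-trans c (≈C-sym (c₁ ⊎-cong c₂))) (p₁ ++-cong p₂)

-- Thinnings: the renamings generated by weakening and by going below a
-- binder.  A context is transported along a thinning by giving the
-- variables outside its image the empty multi type.

data Thin : ℕ → ℕ → Set where
  idT  : ∀ {n} → Thin n n
  skip : ∀ {n m} → Thin (suc n) m → Thin n m
  keep : ∀ {n m} → Thin n m → Thin (suc n) (suc m)

⟦_⟧ : ∀ {n m} → Thin n m → Fin n → Fin m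
⟦ idT ⟧    i = i
⟦ skip ρ ⟧ i = ⟦ ρ ⟧ (suc i)
⟦ keep ρ ⟧ i = liftR ⟦ ρ ⟧ i

push : ∀ {n m} → Thin n m → TCtx n → TCtx m
push idT      Δ = Δ
push (skip ρ) Δ = push ρ (Δ ,∶ 𝟎)
push (keep ρ) Δ = push ρ (tailC Δ) ,∶ Δ zero

push-cong : ∀ {n m} (ρ : Thin n m) {A B : TCtx n} → A ≈C B → push ρ A ≈C push ρ B
push-cong idT      c = c
push-cong (skip ρ) c = push-cong ρ λ { zero → ≈M-refl 𝟎 ; (suc x) → c x }
push-cong (keep ρ) c zero    = c zero
push-cong (keep ρ) c (suc y) = push-cong ρ (λ x → c (suc x)) y

push-∅ : ∀ {n m} (ρ : Thin n m) → push ρ ∅ ≈C ∅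
push-∅ idT      = ≈C-refl
push-∅ (skip ρ) =
  ≈C-trans (push-cong ρ λ { zero → ≈M-refl 𝟎 ; (suc x) → ≈M-refl 𝟎 }) (push-∅ ρ)
push-∅ (keep ρ) zero    = ≈M-refl 𝟎
push-∅ (keep ρ) (suc y) = push-∅ ρ y

push-⊎ : ∀ {n m} (ρ : Thin n m) (A B : TCtx n) → push ρ (A ⊎ B) ≈C (push ρ A ⊎ push ρ B)
push-⊎ idT      A B = ≈C-refl
push-⊎ (skip ρ) A B =
  ≈C-trans (push-cong ρ λ { zero → ≈M-refl 𝟎 ; (suc x) → ≈M-refl (A x ++ B x) })
           (push-⊎ ρ (A ,∶ 𝟎) (B ,∶ 𝟎))
push-⊎ (keep ρ) A B zero    = ≈M-refl (A zero ++ B zero)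
push-⊎ (keep ρ) A B (suc y) = push-⊎ ρ (tailC A) (tailC B) y

push-single : ∀ {n m} (ρ : Thin n m) (x : Fin n) M → push ρ (single x M) ≈C single (⟦ ρ ⟧ x) M
push-single idT      x M = ≈C-refl
push-single (skip ρ) x M = ≈C-trans (push-cong ρ shifted) (push-single ρ (suc x) M)
  where
  shifted : (single x M ,∶ 𝟎) ≈C single (suc x) M
  shifted zero    = ≈M-refl 𝟎
  shifted (suc y) = ≈M-reflexive (sym (single-suc x y M))
push-single (keep ρ) zero    M zero    = ≈M-refl M
push-single (keep ρ) zero    M (suc y) = ≈C-trans (push-cong ρ (λ _ → ≈M-refl 𝟎)) (push-∅ ρ) y
push-single (keep ρ) (suc x) M zero    = ≈M-refl 𝟎
push-single (keep ρ) (suc x) M (suc y) =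
  ≈M-trans (push-cong ρ (λ z → ≈M-reflexive (single-suc x z M)) y)
  (≈M-trans (push-single ρ x M y) (≈M-reflexive (sym (single-suc (⟦ ρ ⟧ x) y M))))

liftR-cong : ∀ {n m} {f g : Fin n → Fin m} → (∀ i → f i ≡ g i) → ∀ i → liftR f i ≡ liftR g i
liftR-cong h zero    = refl
liftR-cong h (suc i) = cong suc (h i)

mutual
  antiRen : ∀ {n n′} (ρ : Thin n n′) {f : Fin n → Fin n′} → (∀ i → f i ≡ ⟦ ρ ⟧ i) →
            (t : Tm n) → ∀ {Γ m e M} → Γ ⊢⟨ m , e ⟩ ren f t ∶ M →
            Σ (TCtx n) λ Γ′ → Γ′ ⊢⟨ m , e ⟩ t ∶ M × Γ ≈C push ρ Γ′
  antiRen ρ h (var x) {M = M} d with inv-var d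
  ... | invVar refl refl cx =
    single x M , ax x M ,
    ≈C-trans cx (≈C-trans (λ y → ≈M-reflexive (cong (λ z → single z M y) (h x)))
                          (≈C-sym (push-single ρ x M)))
  antiRen ρ h (lam b) d with inv-lam d
  ... | invLam Π M′ dm cx eM with antiMany ρ h b dm
  ... | Π′ , dm′ , c = Π′ , conv (many dm′) ≈C-refl eM , ≈C-trans cx c
  antiRen ρ h (app t s) d with inv-app d
  ... | invApp Γ₁ Π₁ M₁ m₁ e₁ m₂ e₂ dt ds cx refl refl with antiRen ρ h t dt | antiRen ρ h s ds
  ... | G , dt′ , c₁ | P , ds′ , c₂ =
    (G ⊎ P) , app dt′ ds′ ,
    ≈C-trans cx (≈C-trans (c₁ ⊎-cong c₂) (≈C-sym (push-⊎ ρ G P)))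
  antiRen ρ h (es t s) d with inv-es d
  ... | invES Γ₁ Π₁ N m₁ e₁ m₂ e₂ dt ds cx refl refl
        with antiRen (keep ρ) (liftR-cong h) t dt | antiRen ρ h s ds
  ... | G , dt′ , c₁ | P , ds′ , c₂ =
    (tailC G ⊎ P) , ES (convC (ctx-η G) dt′) (convT (c₁ zero) ds′) ,
    ≈C-trans cx (≈C-trans ((λ x → c₁ (suc x)) ⊎-cong c₂) (≈C-sym (push-⊎ ρ (tailC G) P)))

  antiMany : ∀ {n n′} (ρ : Thin n n′) {f : Fin n → Fin n′} → (∀ i → f i ≡ ⟦ ρ ⟧ i) →
             (b : Tm (suc n)) → ∀ {Π m e M} → Many (ren (liftR f) b) Π m e M →
             Σ (TCtx n) λ Π′ → Many b Π′ m e M × Π ≈C push ρ Π′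
  antiMany ρ h b [] = ∅ , [] , ≈C-sym (push-∅ ρ)
  antiMany ρ h b (fun dL ∷ dm) with antiRen (keep ρ) (liftR-cong h) b dL | antiMany ρ h b dm
  ... | G , dL′ , c | P , dm′ , c′ =
    (tailC G ⊎ P) ,
    (fun (convC (split-head (≈M-sym (c zero))) dL′) ∷ dm′) ,
    ≈C-trans ((λ x → c (suc x)) ⊎-cong c′) (≈C-sym (push-⊎ ρ (tailC G) P))

thinWk : ∀ {n} k → Thin n (k ⊕ n)
thinWk zero    = idT
thinWk (suc k) = skip (thinWk k)

thinWk-sem : ∀ {n} k (i : Fin n) → wkR k i ≡ ⟦ thinWk k ⟧ i
thinWk-sem zero    i = refl
thinWk-sem (suc k) i = thinWk-sem k (suc i)

wkC : ∀ {n} k → TCtx n → TCtx (k ⊕ n)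
wkC k = push (thinWk k)

antiWk : ∀ {n} k (t : Tm n) {Γ m e M} → Γ ⊢⟨ m , e ⟩ wk k t ∶ M →
         Σ (TCtx n) λ Γ′ → Γ′ ⊢⟨ m , e ⟩ t ∶ M × Γ ≈C wkC k Γ′
antiWk k = antiRen (thinWk k) (thinWk-sem k)

wkC-single : ∀ {n} k (x : Fin n) M → wkC k (single x M) ≈C single (wkR k x) M
wkC-single k x M y =
  ≈M-trans (push-single (thinWk k) x M y) (≈M-reflexive (cong (λ z → single z M y) (sym (thinWk-sem k x))))

-- Counter bookkeeping for one layer around a hole: the hole's share moves
-- to the last position.
module ℕCS = CommSemigroupProperties +-commutativeSemigroup

frame-app₁ : ∀ a b c → a + b + c + 1 ≡ a + c + 1 + b
frame-app₁ = solve-∀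

frame-app₂ : ∀ a b c → a + (b + c) + 1 ≡ a + b + 1 + c
frame-app₂ = solve-∀

frame-es₁ : ∀ a b c → a + b + c ≡ a + c + b
frame-es₁ = ℕCS.xy∙z≈xz∙y

frame-es₂ : ∀ a b c → a + (b + c) ≡ a + b + c
frame-es₂ a b c = sym (+-assoc a b c)

-- A derivation of V⟨u⟩ contains a derivation of the hole u, whose
-- counters add up with those of the surrounding frame; the frame can be
-- refilled with any derivation of the same type for the hole.  If the new
-- hole context arises from the old one by a trade (giving away Δ₁ and
-- receiving Δ₂, both from the outer scope, seen below the k binders of V),
-- then so does the context of the whole term.
record VFrame {n k} (V : VCtx n k) (Γ : TCtx n) (m e : ℕ) (u : Tm (k ⊕ n)) (M : Multi) : Set where
  constructor vframe
  field
    Γh : TCtx (k ⊕ n)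
    Mh : Multi
    mh eh mr er : ℕ
    dh : Γh ⊢⟨ mh , eh ⟩ u ∶ Mh
    em : m ≡ mr + mh
    ee : e ≡ er + eh
    refill : ∀ {Γh′ u′ mh′ eh′} (Δ₁ Δ₂ : TCtx n) →
             (Γh ⊎ wkC k Δ₂) ≈C (Γh′ ⊎ wkC k Δ₁) → Γh′ ⊢⟨ mh′ , eh′ ⟩ u′ ∶ Mh →
             Σ (TCtx n) λ Γ′ → Γ′ ⊢⟨ mr + mh′ , er + eh′ ⟩ plugV V u′ ∶ M ×
                               (Γ ⊎ Δ₂) ≈C (Γ′ ⊎ Δ₁)

vframe-of : ∀ {n k} (V : VCtx n k) {Γ m e u M} → Γ ⊢⟨ m , e ⟩ plugV V u ∶ M → VFrame V Γ m e u M
vframe-of hole {Γ} {m} {e} {M = M} d =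
  vframe Γ M m e 0 0 d refl refl (λ Δ₁ Δ₂ c d′ → _ , d′ , c)
vframe-of (appL V s) d with inv-app d
... | invApp Γ₁ Π₁ M₁ m₁ e₁ m₂ e₂ dt ds cx refl refl with vframe-of V dt
... | vframe Γh Mh mh eh mr er dh refl refl refill =
  vframe Γh Mh mh eh (mr + m₂ + 1) (er + e₂) dh (frame-app₁ mr mh m₂) (frame-es₁ er eh e₂)
    λ {_} {_} {mh′} {eh′} Δ₁ Δ₂ c d′ → let (G , d₁ , c₁) = refill Δ₁ Δ₂ c d′ in
      (G ⊎ Π₁) , castD (frame-app₁ mr mh′ m₂) (frame-es₁ er eh′ e₂) (app d₁ ds) ,
      trade-⊎ʳ {A′ = G} {Δ₁ = Δ₁} cx c₁
vframe-of (esL V s) d with inv-es d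
... | invES Γ₁ Π₁ N m₁ e₁ m₂ e₂ dt ds cx refl refl with vframe-of V dt
... | vframe Γh Mh mh eh mr er dh refl refl refill =
  vframe Γh Mh mh eh (mr + m₂) (er + e₂) dh (frame-es₁ mr mh m₂) (frame-es₁ er eh e₂)
    λ {_} {_} {mh′} {eh′} Δ₁ Δ₂ c d′ →
      let (G , d₁ , c₁) = refill (Δ₁ ,∶ 𝟎) (Δ₂ ,∶ 𝟎) c d′ in
      (tailC G ⊎ Π₁) ,
      castD (frame-es₁ mr mh′ m₂) (frame-es₁ er eh′ e₂)
        (ES (convC (split-head (cancel-𝟎ʳ (≈M-sym (c₁ zero)))) d₁) ds) ,
      trade-⊎ʳ {A′ = tailC G} {Δ₁ = Δ₁} cx (λ x → c₁ (suc x))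
vframe-of (appR t V) d with inv-app d
... | invApp Γ₁ Π₁ M₁ m₁ e₁ m₂ e₂ dt ds cx refl refl with vframe-of V ds
... | vframe Γh Mh mh eh mr er dh refl refl refill =
  vframe Γh Mh mh eh (m₁ + mr + 1) (e₁ + er) dh (frame-app₂ m₁ mr mh) (frame-es₂ e₁ er eh)
    λ {_} {_} {mh′} {eh′} Δ₁ Δ₂ c d′ → let (P , d₁ , c₁) = refill Δ₁ Δ₂ c d′ in
      (Γ₁ ⊎ P) , castD (frame-app₂ m₁ mr mh′) (frame-es₂ e₁ er eh′) (app dt d₁) ,
      trade-⊎ˡ {A′ = P} {Δ₁ = Δ₁} cx c₁
vframe-of (esR t V) d with inv-es d
... | invES Γ₁ Π₁ N m₁ e₁ m₂ e₂ dt ds cx refl refl with vframe-of V ds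
... | vframe Γh Mh mh eh mr er dh refl refl refill =
  vframe Γh Mh mh eh (m₁ + mr) (e₁ + er) dh (frame-es₂ m₁ mr mh) (frame-es₂ e₁ er eh)
    λ {_} {_} {mh′} {eh′} Δ₁ Δ₂ c d′ → let (P , d₁ , c₁) = refill Δ₁ Δ₂ c d′ in
      (Γ₁ ⊎ P) , castD (frame-es₂ m₁ mr mh′) (frame-es₂ e₁ er eh′) (ES dt d₁) ,
      trade-⊎ˡ {A′ = P} {Δ₁ = Δ₁} cx c₁

refill-same : ∀ {n k} {V : VCtx n k} {Γ m e u M} (F : VFrame V Γ m e u M) →
              let open VFrame F in
              ∀ {u′ mh′ eh′} → Γh ⊢⟨ mh′ , eh′ ⟩ u′ ∶ Mh →
              Γ ⊢⟨ mr + mh′ , er + eh′ ⟩ plugV V u′ ∶ M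
refill-same {Γ = Γ} F d′ with VFrame.refill F ∅ ∅ ≈C-refl d′
... | Γ′ , d , c =
  convC (≈C-trans (≈C-sym (⊎-identityʳ Γ′)) (≈C-trans (≈C-sym c) (⊎-identityʳ Γ))) d

-- Substitution contexts pass the type through, so their hole may even be
-- refilled at a different type.  Here trades are one-sided: the new hole
-- context gives away Δ.
record SFrame {n k} (S : SCtx n k) (Γ : TCtx n) (m e : ℕ) (u : Tm (k ⊕ n)) (M : Multi) : Set where
  constructor sframe
  field
    Γh : TCtx (k ⊕ n)
    mh eh mr er : ℕ
    dh : Γh ⊢⟨ mh , eh ⟩ u ∶ M
    em : m ≡ mr + mh
    ee : e ≡ er + eh
    refill : ∀ {Γh′ u′ mh′ eh′ M′} (Δ : TCtx n) → Γh ≈C (Γh′ ⊎ wkC k Δ) →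
             Γh′ ⊢⟨ mh′ , eh′ ⟩ u′ ∶ M′ →
             Σ (TCtx n) λ Γ′ → Γ′ ⊢⟨ mr + mh′ , er + eh′ ⟩ plugS S u′ ∶ M′ ×
                               Γ ≈C (Γ′ ⊎ Δ)

sframe-of : ∀ {n k} (S : SCtx n k) {Γ m e u M} → Γ ⊢⟨ m , e ⟩ plugS S u ∶ M → SFrame S Γ m e u M
sframe-of hole {Γ} {m} {e} d = sframe Γ m e 0 0 d refl refl (λ Δ c d′ → _ , d′ , c)
sframe-of (esL S s) d with inv-es d
... | invES Γ₁ Π₁ N m₁ e₁ m₂ e₂ dt ds cx refl refl with sframe-of S dt
... | sframe Γh mh eh mr er dh refl refl refill =
  sframe Γh mh eh (mr + m₂) (er + e₂) dh (frame-es₁ mr mh m₂) (frame-es₁ er eh e₂)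
    λ {_} {_} {mh′} {eh′} Δ c d′ → let (G , d₁ , c₁) = refill (Δ ,∶ 𝟎) c d′ in
      (tailC G ⊎ Π₁) ,
      castD (frame-es₁ mr mh′ m₂) (frame-es₁ er eh′ e₂)
        (ES (convC (split-head (≈M-trans (≈M-sym (Multiset.++-identityʳ (G zero))) (≈M-sym (c₁ zero))))
                   d₁) ds) ,
      trade-⊎ʳ₁ {A′ = tailC G} {Δ = Δ} cx (λ x → c₁ (suc x))

lam-single : ∀ {n} {Γ : TCtx n} {m e t N M} → (Γ ,∶ N) ⊢⟨ m , e ⟩ t ∶ M →
             Γ ⊢⟨ m , e ⟩ lam t ∶ [ N ⇒ M ]
lam-single {Γ = Γ} {m} {e} d =
  convC (⊎-identityʳ Γ) (castD (+-identityʳ m) (+-identityʳ e) (many (fun d ∷ [])))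

-- The argument s, typed below S, is typed outside
-- S by anti-weakening; the body becomes an abstraction of type [N ⇒ M], and
-- rule (app) costs exactly one multiplicative step.
expand-rootM : ∀ {n k} (S : SCtx n k) (t : Tm (suc (k ⊕ n))) (s : Tm n) {Γ m e M} →
               Γ ⊢⟨ m , e ⟩ plugS S (es t (wk k s)) ∶ M →
               Γ ⊢⟨ suc m , e ⟩ app (plugS S (lam t)) s ∶ M
expand-rootM {k = k} S t s d with sframe-of S d
... | sframe Γh mh eh mr er dh refl refl refill with inv-es dh
... | invES G₁ P₁ N m₁ e₁ m₂ e₂ dt ds cx refl refl with antiWk k s ds
... | P , ds′ , cP with refill P (≈C-trans cx (≈C-refl ⊎-cong cP)) (lam-single dt)
... | Γ′ , dS , cS =
  castD (count-rootM mr m₁ m₂) (+-assoc er e₁ e₂) (convC (≈C-sym cS) (app dS ds′))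
  where
  count-rootM : ∀ a b c → a + b + c + 1 ≡ suc (a + (b + c))
  count-rootM = solve-∀

trade-for-var : ∀ {n k} {Γh : TCtx (k ⊕ n)} {Δ : TCtx n} {x : Fin n} M → Γh ≈C wkC k Δ →
                (Γh ⊎ wkC k (single x M)) ≈C (single (wkR k x) M ⊎ wkC k Δ)
trade-for-var {k = k} {Δ = Δ} {x} M c y =
  ≈M-trans (c y ++-cong wkC-single k x M y) (Multiset.++-comm (wkC k Δ y) (single (wkR k x) M y))

-- Reverse substitution of one occurrence.  A derivation of V⟨⟨u⟩⟩, where u
-- is weakened past the innermost variable x, splits into a derivation of u
-- at some type Mu and a derivation of V⟨⟨x⟩⟩ in which x additionally
-- receives Mu while the other variables give up u's context Δ.  The axiom
-- typing x costs one exponential step.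
record Extraction {n k} (V : VCtx (suc n) k) (u : Tm n) (Γ : TCtx (suc n)) (m e : ℕ) (M : Multi) : Set where
  constructor extraction
  field
    Mu : Multi
    Δ : TCtx n
    Γ′ : TCtx (suc n)
    mu eu mx ex : ℕ
    du : Δ ⊢⟨ mu , eu ⟩ u ∶ Mu
    dx : Γ′ ⊢⟨ mx , suc ex ⟩ plugV⟪ V ⟫ (var zero) ∶ M
    em : m ≡ mx + mu
    ee : e ≡ ex + eu
    head : Γ′ zero ≈M (Γ zero ++ Mu)
    tail : tailC Γ ≈C (tailC Γ′ ⊎ Δ)

extract : ∀ {n k} (V : VCtx (suc n) k) (u : Tm n) {Γ m e M} →
          Γ ⊢⟨ m , e ⟩ plugV⟪ V ⟫ (ren suc u) ∶ M → Extraction V u Γ m e M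
extract {k = k} V u {Γ} d with vframe-of V d
... | vframe Γh Mh mh eh mr er dh em ee refill with antiWk k (ren suc u) dh
... | Δ′ , du′ , c₁ with antiRen (skip idT) (λ _ → refl) u du′
... | Δ , du , c₂ with refill (Δ ,∶ 𝟎) (single zero Mh)
                      (trade-for-var {k = k} {Δ = Δ ,∶ 𝟎} {x = zero} Mh
                                     (≈C-trans c₁ (push-cong (thinWk k) c₂)))
                      (ax (wkR k zero) Mh)
... | Γ′ , dx , c =
  extraction Mh Δ Γ′ mh eh mr er du (castD (+-identityʳ mr) (+-comm er 1) dx) em ee
    (≈M-sym (≈M-trans (c zero) (Multiset.++-identityʳ (Γ′ zero))))
    (λ y → ≈M-trans (≈M-sym (Multiset.++-identityʳ (Γ (suc y)))) (c (suc y)))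

liftk : ∀ {n m} k → (Fin n → Fin m) → Fin (k ⊕ n) → Fin (k ⊕ m)
liftk zero    f = f
liftk (suc k) f = liftk k (liftR f)

liftk-wkR : ∀ {n m} k (f : Fin n → Fin m) i → liftk k f (wkR k i) ≡ wkR k (f i)
liftk-wkR zero    f i = refl
liftk-wkR (suc k) f i = liftk-wkR k (liftR f) (suc i)

ren-plugV : ∀ {n m k} (f : Fin n → Fin m) (V : VCtx n k) (u : Tm (k ⊕ n)) →
            ren f (plugV V u) ≡ plugV (renV f V) (ren (liftk k f) u)
ren-plugV f hole       u = refl
ren-plugV f (appL V s) u = cong (λ z → app z (ren f s)) (ren-plugV f V u)
ren-plugV f (esL V s)  u = cong (λ z → es z (ren f s)) (ren-plugV (liftR f) V u)
ren-plugV f (appR t V) u = cong (app (ren f t)) (ren-plugV f V u)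
ren-plugV f (esR t V)  u = cong (es (ren (liftR f) t)) (ren-plugV f V u)

ren-plugV⟪var⟫ : ∀ {n m k} (f : Fin n → Fin m) (V : VCtx n k) x →
                 ren f (plugV⟪ V ⟫ (var x)) ≡ plugV⟪ renV f V ⟫ (var (f x))
ren-plugV⟪var⟫ {k = k} f V x =
  trans (ren-plugV f V (var (wkR k x))) (cong (λ z → plugV (renV f V) (var z)) (liftk-wkR k f x))

-- Extracting the copy of v from the body
-- gives x the extra type Mv; the two typings of v merge into one typing
-- of the substituted value, which is moved back inside S.  Anti-renaming
-- removes the weakening of V past S.
expand-rootE : ∀ {n k j} (V : VCtx (suc n) k) (S : SCtx n j) (b : Tm (suc (j ⊕ n))) {Γ m e M} →
  Γ ⊢⟨ m , e ⟩ plugS S (es (plugV⟪ renV (liftR (wkR j)) V ⟫ (ren suc (lam b))) (lam b)) ∶ M →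
  Γ ⊢⟨ m , suc e ⟩ es (plugV⟪ V ⟫ (var zero)) (plugS S (lam b)) ∶ M
expand-rootE {j = j} V S b {M = M} d with sframe-of S d
... | sframe Γh mh eh mr er dh refl refl refill with inv-es dh
... | invES G₁ P₁ N m₁ e₁ m₂ e₂ dB dv cx refl refl with extract (renV (liftR (wkR j)) V) (lam b) dB
... | extraction Mv Δ Γ′ mv ev mx ex dv′ dx refl refl head tail
      with antiRen (keep (thinWk j)) (liftR-cong (thinWk-sem j)) (plugV⟪ V ⟫ (var zero))
             (subst (λ w → Γ′ ⊢⟨ mx , suc ex ⟩ w ∶ M)
                    (sym (ren-plugV⟪var⟫ (liftR (wkR j)) V zero)) dx)
... | Γ₃ , dX , c₃ with refill (tailC Γ₃) value-ctx (convT value-type (mergeLam dv dv′))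
  where
  -- the two typings of v, merged, give x its type in the extracted body
  value-type : (N ++ Mv) ≈M Γ₃ zero
  value-type = ≈M-trans (≈M-sym head) (c₃ zero)
  value-ctx : Γh ≈C ((P₁ ⊎ Δ) ⊎ wkC j (tailC Γ₃))
  value-ctx y =
    ≈M-trans (cx y)
    (≈M-trans (≈M-trans (tail y) (c₃ (suc y) ++-cong ≈M-refl (Δ y)) ++-cong ≈M-refl (P₁ y))
              (MultisetCS.xy∙z≈zy∙x (wkC j (tailC Γ₃) y) (Δ y) (P₁ y)))
... | Γ₄ , dS , c₄ =
  castD (count mx mr m₂ mv) (cong suc (count ex er e₂ ev))
    (convC (≈C-sym (≈C-trans c₄ (λ y → Multiset.++-comm (Γ₄ y) (Γ₃ (suc y)))))
      (ES (convC (ctx-η Γ₃) dX) dS))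
  where
  count : ∀ a b c d → a + (b + (c + d)) ≡ b + (a + d + c)
  count = solve-∀

expand-stepM : ∀ {n} {t u : Tm n} {Γ m e M} → Step mul t u → Γ ⊢⟨ m , e ⟩ u ∶ M →
               Γ ⊢⟨ suc m , e ⟩ t ∶ M
expand-stepM (ctx V (rootM S t s)) d with vframe-of V d
... | F@(vframe _ _ mh _ mr _ dh refl refl _) =
  castD (+-suc mr mh) refl (refill-same F (expand-rootM S t s dh))

expand-stepE : ∀ {n} {t u : Tm n} {Γ m e M} → Step exp t u → Γ ⊢⟨ m , e ⟩ u ∶ M →
               Γ ⊢⟨ m , suc e ⟩ t ∶ M
expand-stepE (ctx V (rootE V′ S b)) d with vframe-of V d
... | F@(vframe _ _ _ eh _ er dh refl refl _) =
  castD refl (+-suc er eh) (refill-same F (expand-rootE V′ S b dh))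

normal-tight : ∀ {n} {s : Tm n} → Normal s → ∅ ⊢⟨ 0 , 0 ⟩ s ∶ 𝟎
normal-tight lam      = many []
normal-tight (es p q) = ES {Γ = ∅} {Π = ∅} (convC (ctx-η ∅) (normal-tight p)) (normal-tight q)

theorem4 : (t s : Tm 0) (d : t ⟶* s) → Normal s → Tight ∣ d ∣m ∣ d ∣e t
theorem4 t s done              nf = normal-tight nf
theorem4 t s (step mul st d) nf = expand-stepM st (theorem4 _ s d nf)
theorem4 t s (step exp st d) nf = expand-stepE st (theorem4 _ s d nf)
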